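{- If $f\colon A_1\times A_2\to\mathbb{Q}_{\ge0}$ (with $A_1,A_2$ finite) is a rank-one block matrix, it is uniquely determined by its underlying relation and its row and column totals; that is, any rank-one block matrix $g\colon A_1\times A_2\to\mathbb{Q}_{\ge0}$ with the same underlying relation, the same row sums and the same column sums as $f$ equals $f$.
   Context: The underlying relation of $f$ is $B=\{(x,y):f(x,y)>0\}$. $f$ is a rank-one block matrix if $B$ is rectangular (i.e. $(a,c),(a,d),(b,c)\in B$ implies $(b,d)\in B$) and each block of $f$ has rank one, where the blocks of $f$ are the submatrices induced on the row and column sets of the connected components of the bipartite graph with vertex classes $A_1,A_2$ and edge set $B$; equivalently, $B$ is rectangular and there exist $\alpha_1\colon A_1\to\mathbb{Q}_{\ge0}$, $\alpha_2\colon A_2\to\mathbb{Q}_{\ge0}$ with $f(x,y)=\alpha_1(x)\alpha_2(y)$ for all $(x,y)\in B$. -}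

module Defs where

open import Data.Nat using (ℕ)
open import Data.Fin using (Fin)
open import Data.Rational using (ℚ; 0ℚ; _+_; _*_; _≤_; _<_)
open import Data.Vec.Functional using (foldr)
open import Data.Product using (Σ; _×_; _,_)
open import Relation.Binary.PropositionalEquality using (_≡_)

Matrix : ℕ → ℕ → Set
Matrix m n = Fin m → Fin n → ℚ

NonNeg : ∀ {m n} → Matrix m n → Set
NonNeg f = ∀ x y → 0ℚ ≤ f x y

Rel : ∀ {m n} → Matrix m n → Fin m → Fin n → Set
Rel f x y = 0ℚ < f x y

∑ : ∀ {k} → (Fin k → ℚ) → ℚ
∑ v = foldr _+_ 0ℚ v

rowSum : ∀ {m n} → Matrix m n → Fin m → ℚ
rowSum f x = ∑ (λ y → f x y)

colSum : ∀ {m n} → Matrix m n → Fin n → ℚ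
colSum f y = ∑ (λ x → f x y)

Rectangular : ∀ {m n} → (Fin m → Fin n → Set) → Set
Rectangular B = ∀ a b c d → B a c → B a d → B b c → B b d

-- rank-one block matrix (the "equivalently" form of the definition):
-- B rectangular and f(x,y) = α₁(x) α₂(y) on B for some α₁, α₂ ≥ 0
RankOneBlock : ∀ {m n} → Matrix m n → Set
RankOneBlock {m} {n} f =
  NonNeg f ×
  Rectangular (Rel f) ×
  Σ (Fin m → ℚ) λ α₁ → Σ (Fin n → ℚ) λ α₂ →
    (∀ x → 0ℚ ≤ α₁ x) × (∀ y → 0ℚ ≤ α₂ y) ×
    (∀ x y → Rel f x y → f x y ≡ α₁ x * α₂ y)

SameRel : ∀ {m n} → Matrix m n → Matrix m n → Set
SameRel f g = ∀ x y → (Rel f x y → Rel g x y) × (Rel g x y → Rel f x y)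

-- On the relation B every entry is α₁(x) α₂(y), so the row sum r(x) is α₁(x) times the total of α₂
-- over the support of row x, and similarly for the column sum c(y). Rectangularity makes all rows
-- meeting column y have the same support, whence r(x) c(y) = f(x,y) T(y) for (x,y) ∈ B, where
-- T(y) is the sum of r(x') over the rows x' meeting column y. Since T(y) > 0 depends only on B and
-- the row sums, f(x,y) = r(x) c(y) / T(y) is determined by them; off B both matrices vanish.
module Submission where

open import Defs
open import Algebra.Bundles using (CommutativeMonoid; CommutativeRing)
open import Data.Nat using (ℕ; zero; suc)
open import Data.Fin using (Fin)
open import Data.Rational using (ℚ; 0ℚ; _*_; _≤_; _<_; positive)
open import Data.Rational.Properties
  using (_<?_; ≤-antisym; ≤-refl; ≤-reflexive; ≮⇒≥; +-mono-≤; +-identityˡ; +-identityʳ;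
         *-cancelʳ-≤-pos; *-zeroʳ; *-comm; *-1-commutativeMonoid; +-*-commutativeRing; module ≤-Reasoning)
open import Data.Product using (proj₁; proj₂)
open import Function using (_∘_)
open import Relation.Nullary using (Dec; yes; no; ¬_; contradiction)
open import Relation.Binary.PropositionalEquality using (_≡_; refl; sym; trans; cong; cong₂; subst; module ≡-Reasoning)

open import Algebra.Properties.Semiring.Sum (CommutativeRing.semiring +-*-commutativeRing)
  using (sum-cong-≗; *-distribˡ-sum)
open import Algebra.Properties.CommutativeSemigroup (CommutativeMonoid.commutativeSemigroup *-1-commutativeMonoid)
  using (interchange)

∑-nonneg : ∀ {k} (v : Fin k → ℚ) → (∀ i → 0ℚ ≤ v i) → 0ℚ ≤ ∑ v
∑-nonneg {zero}  v v≥0 = ≤-refl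
∑-nonneg {suc k} v v≥0 = +-mono-≤ (v≥0 Fin.zero) (∑-nonneg (v ∘ Fin.suc) (v≥0 ∘ Fin.suc))

term≤∑ : ∀ {k} (v : Fin k → ℚ) → (∀ i → 0ℚ ≤ v i) → ∀ j → v j ≤ ∑ v
term≤∑ v v≥0 Fin.zero = subst (_≤ ∑ v) (+-identityʳ (v Fin.zero))
  (+-mono-≤ (≤-refl {v Fin.zero}) (∑-nonneg (v ∘ Fin.suc) (v≥0 ∘ Fin.suc)))
term≤∑ v v≥0 (Fin.suc j) = subst (_≤ ∑ v) (+-identityˡ (v (Fin.suc j)))
  (+-mono-≤ (v≥0 Fin.zero) (term≤∑ (v ∘ Fin.suc) (v≥0 ∘ Fin.suc) j))

*-cancelʳ-≡-pos : ∀ p q r → 0ℚ < r → p * r ≡ q * r → p ≡ q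
*-cancelʳ-≡-pos p q r r>0 pr≡qr = ≤-antisym
  (*-cancelʳ-≤-pos r {{positive r>0}} (≤-reflexive pr≡qr))
  (*-cancelʳ-≤-pos r {{positive r>0}} (≤-reflexive (sym pr≡qr)))

keepIf : {P : Set} → Dec P → ℚ → ℚ
keepIf (yes _) v = v
keepIf (no _)  _ = 0ℚ

keepIf-yes : {P : Set} (d : Dec P) → P → ∀ v → keepIf d v ≡ v
keepIf-yes (yes _) _ v = refl
keepIf-yes (no ¬p) p v = contradiction p ¬p

keepIf-nonneg : {P : Set} (d : Dec P) → ∀ {v} → 0ℚ ≤ v → 0ℚ ≤ keepIf d v
keepIf-nonneg (yes _) v≥0 = v≥0
keepIf-nonneg (no _)  _   = ≤-refl

keepIf-*ˡ : {P : Set} (d : Dec P) → ∀ u v → keepIf d (u * v) ≡ u * keepIf d v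
keepIf-*ˡ (yes _) u v = refl
keepIf-*ˡ (no _)  u v = sym (*-zeroʳ u)

keepIf-cong : {P : Set} (d : Dec P) → ∀ {u v} → (P → u ≡ v) → keepIf d u ≡ keepIf d v
keepIf-cong (yes p) u≡v = u≡v p
keepIf-cong (no _)  _   = refl

keepIf-cong-⇔ : {P Q : Set} (d : Dec P) (e : Dec Q) → (P → Q) → (Q → P) →
                ∀ {u v} → (P → u ≡ v) → keepIf d u ≡ keepIf e v
keepIf-cong-⇔ (yes p) (yes _) _   _   u≡v = u≡v p
keepIf-cong-⇔ (no _)  (no _)  _   _   _   = refl
keepIf-cong-⇔ (yes p) (no ¬q) p⇒q _   _   = contradiction (p⇒q p) ¬q
keepIf-cong-⇔ (no ¬p) (yes q) _   q⇒p _   = contradiction (q⇒p q) ¬p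

module _ {m n : ℕ} where

  nonneg-¬Rel⇒0 : (f : Matrix m n) → NonNeg f → ∀ {x y} → ¬ Rel f x y → f x y ≡ 0ℚ
  nonneg-¬Rel⇒0 f f≥0 {x} {y} ¬r = ≤-antisym (≮⇒≥ ¬r) (f≥0 x y)

  rowSumOverColumnSupport : Matrix m n → Fin n → ℚ
  rowSumOverColumnSupport f y = ∑ λ x → keepIf (0ℚ <? f x y) (rowSum f x)

  rowSumOverColumnSupport-pos : (f : Matrix m n) → NonNeg f → ∀ {x y} → Rel f x y →
                                0ℚ < rowSumOverColumnSupport f y
  rowSumOverColumnSupport-pos f f≥0 {x} {y} r = begin-strict
      0ℚ                                             <⟨ r ⟩
      f x y                                          ≤⟨ term≤∑ (f x) (f≥0 x) y ⟩
      rowSum f x                                     ≡⟨ sym (keepIf-yes (0ℚ <? f x y) r _) ⟩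
      keepIf (0ℚ <? f x y) (rowSum f x)              ≤⟨ term≤∑ _ terms≥0 x ⟩
      rowSumOverColumnSupport f y                    ∎
    where
    open ≤-Reasoning
    terms≥0 : ∀ x' → 0ℚ ≤ keepIf (0ℚ <? f x' y) (rowSum f x')
    terms≥0 x' = keepIf-nonneg (0ℚ <? f x' y) (∑-nonneg (f x') (f≥0 x'))

  rowSumOverColumnSupport-cong : (f g : Matrix m n) → SameRel f g → (∀ x → rowSum f x ≡ rowSum g x) →
                                 ∀ y → rowSumOverColumnSupport f y ≡ rowSumOverColumnSupport g y
  rowSumOverColumnSupport-cong f g same rows y = sum-cong-≗ λ x →
    keepIf-cong-⇔ (0ℚ <? f x y) (0ℚ <? g x y) (proj₁ (same x y)) (proj₂ (same x y)) (λ _ → rows x)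

  module RankOneBlockProperties (f : Matrix m n) (R : RankOneBlock f) where
    f≥0  = proj₁ R
    rect = proj₁ (proj₂ R)
    α₁   = proj₁ (proj₂ (proj₂ R))
    α₂   = proj₁ (proj₂ (proj₂ (proj₂ R)))
    f≡α₁α₂ = proj₂ (proj₂ (proj₂ (proj₂ (proj₂ (proj₂ R)))))

    rowWeight : Fin m → ℚ
    rowWeight x = ∑ λ y → keepIf (0ℚ <? f x y) (α₂ y)

    colWeight : Fin n → ℚ
    colWeight y = ∑ λ x → keepIf (0ℚ <? f x y) (α₁ x)

    entry≡keepIf : ∀ x y → f x y ≡ keepIf (0ℚ <? f x y) (α₁ x * α₂ y)
    entry≡keepIf x y with 0ℚ <? f x y
    ... | yes r = f≡α₁α₂ x y r
    ... | no ¬r = nonneg-¬Rel⇒0 f f≥0 ¬r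

    rowSum≡ : ∀ x → rowSum f x ≡ α₁ x * rowWeight x
    rowSum≡ x = trans
      (sum-cong-≗ λ y → trans (entry≡keepIf x y) (keepIf-*ˡ (0ℚ <? f x y) (α₁ x) (α₂ y)))
      (sym (*-distribˡ-sum (α₁ x) λ y → keepIf (0ℚ <? f x y) (α₂ y)))

    colSum≡ : ∀ y → colSum f y ≡ α₂ y * colWeight y
    colSum≡ y = trans
      (sum-cong-≗ λ x → trans (entry≡keepIf x y)
        (trans (cong (keepIf (0ℚ <? f x y)) (*-comm (α₁ x) (α₂ y))) (keepIf-*ˡ (0ℚ <? f x y) (α₂ y) (α₁ x))))
      (sym (*-distribˡ-sum (α₂ y) λ x → keepIf (0ℚ <? f x y) (α₁ x)))

    rowWeight-const : ∀ {x x' y} → Rel f x y → Rel f x' y → rowWeight x' ≡ rowWeight x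
    rowWeight-const {x} {x'} {y} r r' = sum-cong-≗ λ y' →
      keepIf-cong-⇔ (0ℚ <? f x' y') (0ℚ <? f x y')
        (λ r'' → rect x' x y y' r' r'' r) (λ r'' → rect x x' y y' r r'' r') (λ _ → refl)

    rowSumOverColumnSupport≡ : ∀ {x y} → Rel f x y → rowSumOverColumnSupport f y ≡ rowWeight x * colWeight y
    rowSumOverColumnSupport≡ {x} {y} r = trans
      (sum-cong-≗ λ x' → trans
        (keepIf-cong (0ℚ <? f x' y) λ r' →
          trans (rowSum≡ x') (trans (cong (α₁ x' *_) (rowWeight-const r r')) (*-comm (α₁ x') (rowWeight x))))
        (keepIf-*ˡ (0ℚ <? f x' y) (rowWeight x) (α₁ x')))
      (sym (*-distribˡ-sum (rowWeight x) λ x' → keepIf (0ℚ <? f x' y) (α₁ x')))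

    rowSum*colSum≡ : ∀ {x y} → Rel f x y → rowSum f x * colSum f y ≡ f x y * rowSumOverColumnSupport f y
    rowSum*colSum≡ {x} {y} r = begin
        rowSum f x * colSum f y                        ≡⟨ cong₂ _*_ (rowSum≡ x) (colSum≡ y) ⟩
        (α₁ x * rowWeight x) * (α₂ y * colWeight y)    ≡⟨ interchange (α₁ x) (rowWeight x) (α₂ y) (colWeight y) ⟩
        (α₁ x * α₂ y) * (rowWeight x * colWeight y)    ≡⟨ cong₂ _*_ (sym (f≡α₁α₂ x y r)) (sym (rowSumOverColumnSupport≡ r)) ⟩
        f x y * rowSumOverColumnSupport f y            ∎
      where open ≡-Reasoning

open RankOneBlockProperties using (rowSum*colSum≡)

lemma6p6 : (m n : ℕ) (f g : Matrix m n) →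
    RankOneBlock f → RankOneBlock g → SameRel f g →
    (∀ x → rowSum f x ≡ rowSum g x) → (∀ y → colSum f y ≡ colSum g y) →
    ∀ x y → f x y ≡ g x y
lemma6p6 m n f g Rf Rg same rows cols x y with 0ℚ <? f x y
... | no ¬r = trans (nonneg-¬Rel⇒0 f (proj₁ Rf) ¬r)
                    (sym (nonneg-¬Rel⇒0 g (proj₁ Rg) (¬r ∘ proj₂ (same x y))))
... | yes r = *-cancelʳ-≡-pos (f x y) (g x y) _ (rowSumOverColumnSupport-pos f (proj₁ Rf) r) (begin
    f x y * rowSumOverColumnSupport f y   ≡⟨ sym (rowSum*colSum≡ f Rf r) ⟩
    rowSum f x * colSum f y               ≡⟨ cong₂ _*_ (rows x) (cols y) ⟩
    rowSum g x * colSum g y               ≡⟨ rowSum*colSum≡ g Rg (proj₁ (same x y) r) ⟩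
    g x y * rowSumOverColumnSupport g y   ≡⟨ cong (g x y *_) (sym (rowSumOverColumnSupport-cong f g same rows y)) ⟩
    g x y * rowSumOverColumnSupport f y   ∎)
  where open ≡-Reasoning
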